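{- Let $G$ be a $2$-connected simple graph on $[N]$ with an edge $e=uv$ such that $\deg_G(u)=2$. For $c\in\mathfrak{D}(G)$ let $\alpha(c)=(c,1)\in\mathbb{Z}^{N+1}$ and $\gamma'(c)=\alpha(c)-e_u+e_{N+1}$, and define $\gamma(c)$ as follows: (1) if $c\notin\mathfrak{D}(G\setminus e)$: set $\gamma(c)=\gamma'(c)$ if $\gamma'(c)\in\mathfrak{D}(G\mathbin{:}e)$, and $\gamma(c)=\alpha(c)+e_u-e_{N+1}$ otherwise; (2) if $c\in\mathfrak{D}(G\setminus e)$: set $\gamma(c)=\gamma'(c)$ if $\gamma'(c)\in\mathfrak{D}(G\mathbin{:}e)$, and $\gamma(c)=\alpha(c)+e_v-e_{N+1}$ otherwise. Then $\gamma(c)\in\mathfrak{D}(G\mathbin{:}e)$ for every $c\in\mathfrak{D}(G)$, and $\gamma:\mathfrak{D}(G)\to\mathfrak{D}(G\mathbin{:}e)$ is injective.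
   Context: Let $\mathcal{N}_G(i)$ denote the set of neighbors of $i$ in a graph $G$ on $[N]$. A sequence $(a_1,\dots,a_N)\in\mathbb{Z}_{\ge0}^N$ is $D(G)$-draconian if $\sum_i a_i=N-1$ and for every nonempty $S\subseteq[N]$, $\sum_{i\in S}a_i<\left|S\cup\bigcup_{i\in S}\mathcal{N}_G(i)\right|$; $\mathfrak{D}(G)$ is the set of such sequences (in particular all entries are nonnegative integers). $G\setminus e$ is $G$ with the edge $e$ deleted. $G\mathbin{:}e$ is the graph on $[N+1]$ with edge set $(E(G)\setminus\{uv\})\cup\{u(N+1),v(N+1)\}$. $e_1,\dots,e_{N+1}$ are the standard basis vectors of $\mathbb{R}^{N+1}$. -}

module Defs where

open import Data.Bool using (Bool; true; false; _∧_; _∨_; not; if_then_else_; T)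
open import Data.Nat using (ℕ; zero; suc; _∸_; _≤_)
open import Data.Integer as ℤ using (ℤ; +_; _+_; _-_; _<_)
open import Data.Integer.Properties using (_<?_; _≤?_; _≟_)
open import Data.Fin using (Fin; zero; suc; inject₁; fromℕ)
open import Data.Fin.Properties as FinP using (any?; all?)
open import Data.Fin.Subset using (Subset; Nonempty; ∣_∣)
open import Data.Fin.Subset.Properties using (anySubset?; nonempty?)
open import Data.Maybe using (Maybe; just; nothing)
import Data.Maybe as Maybe
open import Data.Vec using (lookup; tabulate)
open import Data.Product using (Σ; ∃; _×_; _,_)
open import Data.Empty using (⊥)
open import Data.Unit using (⊤)
open import Relation.Nullary using (¬_; Dec; yes; no; ⌊_⌋)
open import Relation.Nullary.Decidable using (_×-dec_; _→-dec_; decidable-stable)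
open import Relation.Binary.PropositionalEquality using (_≡_; _≢_)

Adj : ℕ → Set
Adj n = Fin n → Fin n → Bool

record SimpleGraph (n : ℕ) : Set where
  field
    adj    : Adj n
    sym    : ∀ i j → adj i j ≡ adj j i
    irrefl : ∀ i → adj i i ≡ false
open SimpleGraph public

anyFin : ∀ {n} → (Fin n → Bool) → Bool
anyFin {zero}  f = false
anyFin {suc n} f = f zero ∨ anyFin (λ i → f (suc i))

countFin : ∀ {n} → (Fin n → Bool) → ℕ
countFin {zero}  f = zero
countFin {suc n} f = (if f zero then 1 else 0) Data.Nat.+ countFin (λ i → f (suc i))

sumFin : ∀ {n} → (Fin n → ℤ) → ℤ
sumFin {zero}  f = + 0
sumFin {suc n} f = f zero + sumFin (λ i → f (suc i))

deg : ∀ {n} → SimpleGraph n → Fin n → ℕ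
deg G u = countFin (adj G u)

data Walk {n : ℕ} (A : Adj n) (P : Fin n → Set) : Fin n → Fin n → Set where
  here : ∀ {i} → P i → Walk A P i i
  step : ∀ {i j k} → P i → A i j ≡ true → Walk A P j k → Walk A P i k

Connected : ∀ {n} → SimpleGraph n → Set
Connected {n} G = ∀ (i j : Fin n) → Walk (adj G) (λ _ → ⊤) i j

TwoConnected : ∀ {n} → SimpleGraph n → Set
TwoConnected {n} G =
  (3 ≤ n) × Connected G ×
  (∀ (v i j : Fin n) → i ≢ v → j ≢ v → Walk (adj G) (λ k → k ≢ v) i j)

closedNbhd : ∀ {n} → Adj n → Subset n → Subset n
closedNbhd A S = tabulate (λ j → lookup S j ∨ anyFin (λ i → lookup S i ∧ A i j))

sumOver : ∀ {n} → Subset n → (Fin n → ℤ) → ℤ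
sumOver S a = sumFin (λ i → if lookup S i then a i else + 0)

Draconian : ∀ {n} → Adj n → (Fin n → ℤ) → Set
Draconian {n} A a =
  (∀ i → + 0 ℤ.≤ a i) ×
  (sumFin a ≡ + (n ∸ 1)) ×
  (∀ (S : Subset n) → Nonempty S → sumOver S a < + ∣ closedNbhd A S ∣)

draconian? : ∀ {n} (A : Adj n) (a : Fin n → ℤ) → Dec (Draconian A a)
draconian? {n} A a =
  all? (λ i → + 0 ≤? a i) ×-dec (sumFin a ≟ + (n ∸ 1)) ×-dec subsets?
  where
    Q : Subset n → Set
    Q S = Nonempty S → sumOver S a < + ∣ closedNbhd A S ∣
    Q? : ∀ S → Dec (Q S)
    Q? S = nonempty? S →-dec (sumOver S a <? + ∣ closedNbhd A S ∣)
    subsets? : Dec (∀ S → Q S)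
    subsets? with anySubset? (λ S → Relation.Nullary.¬? (Q? S))
    ... | yes (S , ¬q) = no (λ h → ¬q (h S))
    ... | no ¬ex = yes (λ S → decidable-stable (Q? S) (λ ¬q → ¬ex (S , ¬q)))

eqb : ∀ {n} → Fin n → Fin n → Bool
eqb i j = ⌊ i FinP.≟ j ⌋

deleteEdge : ∀ {n} → Adj n → Fin n → Fin n → Adj n
deleteEdge A u v i j =
  A i j ∧ not ((eqb i u ∧ eqb j v) ∨ (eqb i v ∧ eqb j u))

-- view of Fin (suc n): old vertex (inject₁ k ↦ just k) or the new vertex
-- N+1 (fromℕ n ↦ nothing)
split : ∀ {n} → Fin (suc n) → Maybe (Fin n)
split {zero}  zero    = nothing
split {suc n} zero    = just zero
split {suc n} (suc i) = Maybe.map suc (split i)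

subdivide : ∀ {n} → Adj n → Fin n → Fin n → Adj (suc n)
subdivide A u v i j with split i | split j
... | just a  | just b  = deleteEdge A u v a b
... | just a  | nothing = eqb a u ∨ eqb a v
... | nothing | just b  = eqb b u ∨ eqb b v
... | nothing | nothing = false

basis : ∀ {n} → Fin n → Fin n → ℤ
basis k i = if eqb i k then + 1 else + 0

α : ∀ {n} → (Fin n → ℤ) → Fin (suc n) → ℤ
α c i with split i
... | just k  = c k
... | nothing = + 1

new : ∀ {n} → Fin (suc n)
new {n} = fromℕ n

shift : ∀ {n} → (Fin (suc n) → ℤ) → Fin (suc n) → Fin (suc n) → Fin (suc n) → ℤ
shift a x y i = a i + basis x i - basis y i

γ′ : ∀ {n} → Fin n → (Fin n → ℤ) → Fin (suc n) → ℤ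
γ′ u c = shift (α c) new (inject₁ u)

γ : ∀ {n} → SimpleGraph n → Fin n → Fin n → (Fin n → ℤ) → Fin (suc n) → ℤ
γ G u v c with draconian? (subdivide (adj G) u v) (γ′ u c)
... | yes _ = γ′ u c
... | no  _ with draconian? (deleteEdge (adj G) u v) c
...   | no  _ = shift (α c) (inject₁ u) new
...   | yes _ = shift (α c) (inject₁ v) new

{-# OPTIONS --safe #-}
-- For P ⊆ [N+1] with old part T, the closed neighbourhood of P in G : e contains
-- N_{G∖e}[T], together with N+1 when T meets {u, v}, and it contains N_{G∖e}[T] ∪ {u, v, N+1}
-- when N+1 ∈ P.  As |N_G[T]| ≤ |N_{G∖e}[T]| + [T meets {u, v}], the draconian inequalities of c
-- in G give those of α(c) + e_x − e_{N+1} for almost every P.  The exceptions are the sets T ∋ u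
-- that are tight for c in G ∖ e; such a T has v ∉ N_{G∖e}[T] and c_u ≥ 1, and then
-- submodularity of T ↦ |N[T]| played against additivity of c shows γ′(c) ∈ D(G : e), so
-- case (1) never reaches such a T.
-- For injectivity, the entry at N+1 (2 for γ′, 0 otherwise) separates γ′ from the other two
-- maps, each of which is injective.  If α(c) + e_u = α(c′) + e_v with c ∉ D(G∖e) and
-- c′ ∈ D(G∖e), a tight set of c feeds the same submodularity argument and gives
-- γ′(c′) ∈ D(G : e), contradicting the case of c′.
module Submission where

open import Defs
open import Data.Bool using (Bool; true; false; _∧_; _∨_; not; if_then_else_)
import Data.Bool.Properties as Boolₚ
open import Data.Nat as ℕ using (ℕ; zero; suc; z≤n; s≤s)
import Data.Nat.Properties as ℕₚ
open import Data.Integer using (ℤ; +_; _+_; _-_; -_; _≤_; _<_; +≤+; +<+)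
import Data.Integer.Properties as ℤₚ
open import Data.Integer.Tactic.RingSolver using (solve-∀)
open import Algebra.Properties.AbelianGroup ℤₚ.+-0-abelianGroup using (∙-cancelʳ)
open import Algebra.Properties.CommutativeSemigroup ℤₚ.+-commutativeSemigroup using (interchange)
open import Data.Fin using (Fin; zero; suc; inject₁; fromℕ)
import Data.Fin.Properties as Finₚ
open import Data.Fin.Subset using (Nonempty; ∣_∣)
open import Data.Maybe using (just; nothing)
import Data.Maybe as Maybe
open import Data.Product using (∃; _×_; _,_; proj₁; proj₂)
open import Data.Sum using (_⊎_; inj₁; inj₂; [_,_]′)
open import Data.Empty using (⊥; ⊥-elim)
open import Data.Vec using (lookup; tabulate)
import Data.Vec.Properties as Vecₚ
open import Function using (_∘_)
open import Relation.Nullary using (¬_; yes; no)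
import Relation.Binary.PropositionalEquality as ≡
open ≡ using (_≡_; _≢_; _≗_; refl; cong; cong₂; subst; trans)

private
  variable
    n : ℕ

∨-true⁻ : ∀ {a b} → a ∨ b ≡ true → a ≡ true ⊎ b ≡ true
∨-true⁻ {true}  _ = inj₁ refl
∨-true⁻ {false} b = inj₂ b

∨-trueˡ : ∀ {a} b → a ≡ true → a ∨ b ≡ true
∨-trueˡ b refl = refl

∨-trueʳ : ∀ a {b} → b ≡ true → a ∨ b ≡ true
∨-trueʳ true  _ = refl
∨-trueʳ false b = b

∧-true⁻ : ∀ {a b} → a ∧ b ≡ true → a ≡ true × b ≡ true
∧-true⁻ {true} {true} _ = refl , refl

∧-true : ∀ {a b} → a ≡ true → b ≡ true → a ∧ b ≡ true
∧-true refl refl = refl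

true≢false : ∀ {b} → b ≡ true → b ≡ false → ⊥
true≢false refl ()

eqb-refl : (x : Fin n) → eqb x x ≡ true
eqb-refl x with x Finₚ.≟ x
... | yes _  = refl
... | no x≢x = ⊥-elim (x≢x refl)

eqb-false : {x y : Fin n} → x ≢ y → eqb x y ≡ false
eqb-false {x = x} {y} x≢y with x Finₚ.≟ y
... | yes x≡y = ⊥-elim (x≢y x≡y)
... | no _    = refl

eqb-sound : {x y : Fin n} → eqb x y ≡ true → x ≡ y
eqb-sound {x = x} {y} e with x Finₚ.≟ y
... | yes x≡y = x≡y

eqb-injective : ∀ {m} (f : Fin m → Fin n) → (∀ {a b} → f a ≡ f b → a ≡ b) →
                ∀ a b → eqb (f a) (f b) ≡ eqb a b
eqb-injective f f-inj a b with a Finₚ.≟ b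
... | yes refl = eqb-refl (f a)
... | no a≢b   = eqb-false (a≢b ∘ f-inj)

data OldOrNew {n} : Fin (suc n) → Set where
  old   : (k : Fin n) → OldOrNew (inject₁ k)
  isNew : OldOrNew (fromℕ n)

oldOrNew : (i : Fin (suc n)) → OldOrNew i
oldOrNew {zero}  zero    = isNew
oldOrNew {suc n} zero    = old zero
oldOrNew {suc n} (suc i) with oldOrNew i
... | old k = old (suc k)
... | isNew = isNew

split-inject₁ : (k : Fin n) → split (inject₁ k) ≡ just k
split-inject₁ {suc n} zero    = refl
split-inject₁ {suc n} (suc k) = cong (Maybe.map suc) (split-inject₁ k)

split-new : split (new {n}) ≡ nothing
split-new {zero}  = refl
split-new {suc n} = cong (Maybe.map suc) (split-new {n})

eqb-inject₁-new : (k : Fin n) → eqb (inject₁ k) new ≡ false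
eqb-inject₁-new k = eqb-false (Finₚ.fromℕ≢inject₁ ∘ ≡.sym)

eqb-new-inject₁ : (k : Fin n) → eqb new (inject₁ k) ≡ false
eqb-new-inject₁ k = eqb-false Finₚ.fromℕ≢inject₁

-- Finite subsets of [n] as Boolean predicates

infix  4 _⊆_
infixr 6 _∪_
infixr 7 _∩_
infixl 8 _∖_

_⊆_ : (Fin n → Bool) → (Fin n → Bool) → Set
p ⊆ q = ∀ k → p k ≡ true → q k ≡ true

_∪_ _∩_ : (Fin n → Bool) → (Fin n → Bool) → Fin n → Bool
(p ∪ q) k = p k ∨ q k
(p ∩ q) k = p k ∧ q k

⁅_⁆ : Fin n → Fin n → Bool
⁅ x ⁆ k = eqb k x

_∖_ : (Fin n → Bool) → Fin n → Fin n → Bool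
(p ∖ x) k = p k ∧ not (eqb k x)

∩⊆ˡ : (p q : Fin n → Bool) → p ∩ q ⊆ p
∩⊆ˡ p q k = proj₁ ∘ ∧-true⁻ {p k}

∩⊆ʳ : (p q : Fin n → Bool) → p ∩ q ⊆ q
∩⊆ʳ p q k = proj₂ ∘ ∧-true⁻ {p k}

nonempty⊎empty : (p : Fin n → Bool) → (∃ λ k → p k ≡ true) ⊎ (∀ k → p k ≡ false)
nonempty⊎empty p with Finₚ.any? (λ k → p k Boolₚ.≟ true)
... | yes ∃p = inj₁ ∃p
... | no ¬∃p = inj₂ λ k → Boolₚ.¬-not λ pk → ¬∃p (k , pk)

any-intro : (f : Fin n → Bool) (x : Fin n) → f x ≡ true → anyFin f ≡ true
any-intro f zero    fx = ∨-trueˡ _ fx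
any-intro f (suc x) fx = ∨-trueʳ (f zero) (any-intro (f ∘ suc) x fx)

any-elim : (f : Fin n → Bool) → anyFin f ≡ true → ∃ λ x → f x ≡ true
any-elim {suc n} f h with ∨-true⁻ {f zero} h
... | inj₁ f0 = zero , f0
... | inj₂ fs with any-elim (f ∘ suc) fs
...   | x , fx = suc x , fx

ι : Bool → ℕ
ι b = if b then 1 else 0

ι≤1 : ∀ b → + ι b ≤ + 1
ι≤1 true  = ℤₚ.≤-refl
ι≤1 false = +≤+ z≤n

ι-mono : ∀ {a b} → (a ≡ true → b ≡ true) → ι a ℕ.≤ ι b
ι-mono {false} _   = z≤n
ι-mono {true}  a⇒b rewrite a⇒b refl = ℕₚ.≤-refl

count-cong : {p q : Fin n → Bool} → p ≗ q → countFin p ≡ countFin q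
count-cong {zero}  p≗q = refl
count-cong {suc n} p≗q = cong₂ (λ b m → ι b ℕ.+ m) (p≗q zero) (count-cong (p≗q ∘ suc))

count-∅ : (p : Fin n → Bool) → (∀ k → p k ≡ false) → countFin p ≡ 0
count-∅ {zero}  p empty = refl
count-∅ {suc n} p empty rewrite empty zero = count-∅ (p ∘ suc) (empty ∘ suc)

count-⊆ : (p q : Fin n → Bool) → p ⊆ q → countFin p ℕ.≤ countFin q
count-⊆ {zero}  p q p⊆q = z≤n
count-⊆ {suc n} p q p⊆q =
  ℕₚ.+-mono-≤ (ι-mono (p⊆q zero)) (count-⊆ (p ∘ suc) (q ∘ suc) (p⊆q ∘ suc))

count-⊂ : (p q : Fin n → Bool) → p ⊆ q → (x : Fin n) → q x ≡ true → p x ≡ false →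
          suc (countFin p) ℕ.≤ countFin q
count-⊂ p q p⊆q zero qx px rewrite qx | px =
  s≤s (count-⊆ (p ∘ suc) (q ∘ suc) (p⊆q ∘ suc))
count-⊂ p q p⊆q (suc x) qx px =
  ℕₚ.≤-trans (ℕₚ.≤-reflexive (≡.sym (ℕₚ.+-suc (ι (p zero)) _)))
    (ℕₚ.+-mono-≤ (ι-mono (p⊆q zero)) (count-⊂ (p ∘ suc) (q ∘ suc) (p⊆q ∘ suc) x qx px))

count-∪-∩ : (p q : Fin n → Bool) →
            countFin (p ∪ q) ℕ.+ countFin (p ∩ q) ≡ countFin p ℕ.+ countFin q
count-∪-∩ {zero}  p q = refl
count-∪-∩ {suc n} p q with p zero | q zero | count-∪-∩ (p ∘ suc) (q ∘ suc)
... | true  | true  | ih = cong suc (trans (ℕₚ.+-suc _ _) (trans (cong suc ih) (≡.sym (ℕₚ.+-suc _ _))))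
... | true  | false | ih = cong suc ih
... | false | true  | ih = trans (cong suc ih) (≡.sym (ℕₚ.+-suc _ _))
... | false | false | ih = ih

count-⁅⁆ : (x : Fin n) → countFin ⁅ x ⁆ ≡ 1
count-⁅⁆ {suc n} zero    =
  cong suc (count-∅ {n} (λ k → eqb (suc k) zero) λ k → eqb-false (Finₚ.0≢1+n {i = k} ∘ ≡.sym))
count-⁅⁆ {suc n} (suc x) =
  trans (count-cong (λ k → eqb-injective suc Finₚ.suc-injective k x)) (count-⁅⁆ x)

count-≤-suc : (p q : Fin n → Bool) (x : Fin n) → (∀ k → p k ≡ true → q k ≡ true ⊎ k ≡ x) →
              countFin p ℕ.≤ suc (countFin q)
count-≤-suc p q x p⊆q∪x = begin
  countFin p                                      ≤⟨ count-⊆ p (q ∪ ⁅ x ⁆) p⊆ ⟩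
  countFin (q ∪ ⁅ x ⁆)                             ≤⟨ ℕₚ.m≤m+n _ _ ⟩
  countFin (q ∪ ⁅ x ⁆) ℕ.+ countFin (q ∩ ⁅ x ⁆)    ≡⟨ count-∪-∩ q ⁅ x ⁆ ⟩
  countFin q ℕ.+ countFin ⁅ x ⁆                    ≡⟨ cong (countFin q ℕ.+_) (count-⁅⁆ x) ⟩
  countFin q ℕ.+ 1                                 ≡⟨ ℕₚ.+-comm _ 1 ⟩
  suc (countFin q)                                 ∎
  where
  open ℕₚ.≤-Reasoning
  p⊆ : p ⊆ q ∪ ⁅ x ⁆
  p⊆ k pk with p⊆q∪x k pk
  ... | inj₁ qk   = ∨-trueˡ _ qk
  ... | inj₂ refl = ∨-trueʳ (q k) (eqb-refl k)

count-pos : (q : Fin n → Bool) (x : Fin n) → q x ≡ true → 1 ℕ.≤ countFin q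
count-pos q x qx = ℕₚ.≤-trans (s≤s z≤n) (count-⊂ (λ _ → false) q (λ _ ()) x qx refl)

count-two : (q : Fin n → Bool) {x y : Fin n} → q x ≡ true → q y ≡ true → x ≢ y → 2 ℕ.≤ countFin q
count-two q {x} {y} qx qy x≢y = ℕₚ.≤-trans (ℕₚ.≤-reflexive (cong suc (≡.sym (count-⁅⁆ x))))
  (count-⊂ ⁅ x ⁆ q x⊆q y qy (eqb-false (x≢y ∘ ≡.sym)))
  where
  x⊆q : ⁅ x ⁆ ⊆ q
  x⊆q k k≡x rewrite eqb-sound k≡x = qx

count-inject₁ : (p : Fin (suc n) → Bool) → countFin p ≡ countFin (p ∘ inject₁) ℕ.+ ι (p new)
count-inject₁ {zero}  p with p zero
... | true  = refl
... | false = refl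
count-inject₁ {suc n} p = trans (cong (ι (p zero) ℕ.+_) (count-inject₁ (p ∘ suc)))
  (≡.sym (ℕₚ.+-assoc (ι (p zero)) _ _))

sum-cong : {f g : Fin n → ℤ} → f ≗ g → sumFin f ≡ sumFin g
sum-cong {zero}  f≗g = refl
sum-cong {suc n} f≗g = cong₂ _+_ (f≗g zero) (sum-cong (f≗g ∘ suc))

sum-+ : (f g : Fin n → ℤ) → sumFin (λ k → f k + g k) ≡ sumFin f + sumFin g
sum-+ {zero}  f g = refl
sum-+ {suc n} f g = trans (cong (_+_ (f zero + g zero)) (sum-+ (f ∘ suc) (g ∘ suc)))
  (interchange (f zero) (g zero) (sumFin (f ∘ suc)) (sumFin (g ∘ suc)))

sum-neg : (f : Fin n → ℤ) → sumFin (λ k → - f k) ≡ - sumFin f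
sum-neg {zero}  f = refl
sum-neg {suc n} f = trans (cong (_+_ (- f zero)) (sum-neg (f ∘ suc)))
  (≡.sym (ℤₚ.neg-distrib-+ (f zero) (sumFin (f ∘ suc))))

sum-- : (f g : Fin n → ℤ) → sumFin (λ k → f k - g k) ≡ sumFin f - sumFin g
sum-- f g = trans (sum-+ f (-_ ∘ g)) (cong (_+_ (sumFin f)) (sum-neg g))

sum-zero : (f : Fin n → ℤ) → (∀ k → f k ≡ + 0) → sumFin f ≡ + 0
sum-zero {zero}  f f≡0 = refl
sum-zero {suc n} f f≡0 = cong₂ _+_ (f≡0 zero) (sum-zero (f ∘ suc) (f≡0 ∘ suc))

sum-inject₁ : (f : Fin (suc n) → ℤ) → sumFin f ≡ sumFin (f ∘ inject₁) + f new
sum-inject₁ {zero}  f = trans (ℤₚ.+-identityʳ (f zero)) (≡.sym (ℤₚ.+-identityˡ (f zero)))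
sum-inject₁ {suc n} f = trans (cong (_+_ (f zero)) (sum-inject₁ (f ∘ suc)))
  (≡.sym (ℤₚ.+-assoc (f zero) _ _))

_↾_ : (Fin n → ℤ) → (Fin n → Bool) → Fin n → ℤ
(a ↾ T) k = if T k then a k else + 0

sumOn : (Fin n → Bool) → (Fin n → ℤ) → ℤ
sumOn T a = sumFin (a ↾ T)

sumOn-⁅⁆ : (x : Fin n) (z : ℤ) → sumOn ⁅ x ⁆ (λ _ → z) ≡ z
sumOn-⁅⁆ {suc n} zero z = trans (cong (_+_ z) (sum-zero {n} _ off-zero)) (ℤₚ.+-identityʳ z)
  where
  off-zero : ∀ k → (if eqb (suc k) zero then z else + 0) ≡ + 0
  off-zero k rewrite eqb-false (Finₚ.0≢1+n {i = k} ∘ ≡.sym) = refl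
sumOn-⁅⁆ {suc n} (suc x) z = trans (ℤₚ.+-identityˡ _)
  (trans (sum-cong λ k → cong (λ b → if b then z else + 0) (eqb-injective suc Finₚ.suc-injective k x))
         (sumOn-⁅⁆ x z))

sumOn-cong : (T : Fin n → Bool) {a b : Fin n → ℤ} → a ≗ b → sumOn T a ≡ sumOn T b
sumOn-cong T a≗b = sum-cong λ k → cong (λ t → if T k then t else + 0) (a≗b k)

sumOn-congˡ : {T T′ : Fin n → Bool} (a : Fin n → ℤ) → T ≗ T′ → sumOn T a ≡ sumOn T′ a
sumOn-congˡ a T≗T′ = sum-cong λ k → cong (λ b → if b then a k else + 0) (T≗T′ k)

sumOn-∅ : (T : Fin n → Bool) (a : Fin n → ℤ) → (∀ k → T k ≡ false) → sumOn T a ≡ + 0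
sumOn-∅ T a empty = sum-zero _ λ k → cong (λ b → if b then a k else + 0) (empty k)

sumOn-∪-∩ : (T T′ : Fin n → Bool) (a : Fin n → ℤ) →
            sumOn (T ∪ T′) a + sumOn (T ∩ T′) a ≡ sumOn T a + sumOn T′ a
sumOn-∪-∩ T T′ a = begin
  sumOn (T ∪ T′) a + sumOn (T ∩ T′) a                  ≡⟨ sum-+ (a ↾ (T ∪ T′)) (a ↾ (T ∩ T′)) ⟨
  sumFin (λ k → (a ↾ (T ∪ T′)) k + (a ↾ (T ∩ T′)) k)   ≡⟨ sum-cong (λ k → pointwise (T k) (T′ k) k) ⟩
  sumFin (λ k → (a ↾ T) k + (a ↾ T′) k)                ≡⟨ sum-+ (a ↾ T) (a ↾ T′) ⟩
  sumOn T a + sumOn T′ a                               ∎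
  where
  open ≡.≡-Reasoning
  pointwise : ∀ b b′ k → (if b ∨ b′ then a k else + 0) + (if b ∧ b′ then a k else + 0) ≡
                         (if b then a k else + 0) + (if b′ then a k else + 0)
  pointwise true  true  k = refl
  pointwise true  false k = refl
  pointwise false true  k = ℤₚ.+-comm (a k) (+ 0)
  pointwise false false k = refl

sumOn-+ : (T : Fin n → Bool) (a b : Fin n → ℤ) → sumOn T (λ k → a k + b k) ≡ sumOn T a + sumOn T b
sumOn-+ T a b = trans (sum-cong pointwise) (sum-+ (a ↾ T) (b ↾ T))
  where
  pointwise : ∀ k → (if T k then a k + b k else + 0) ≡ (a ↾ T) k + (b ↾ T) k
  pointwise k with T k
  ... | true  = refl
  ... | false = refl

sumOn-- : (T : Fin n → Bool) (a b : Fin n → ℤ) → sumOn T (λ k → a k - b k) ≡ sumOn T a - sumOn T b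
sumOn-- T a b = trans (sum-cong pointwise) (sum-- (a ↾ T) (b ↾ T))
  where
  pointwise : ∀ k → (if T k then a k - b k else + 0) ≡ (a ↾ T) k - (b ↾ T) k
  pointwise k with T k
  ... | true  = refl
  ... | false = refl

sumOn-basis : (T : Fin n → Bool) (x : Fin n) → sumOn T (basis x) ≡ + ι (T x)
sumOn-basis T x = trans (sum-cong pointwise) (sumOn-⁅⁆ x (+ ι (T x)))
  where
  pointwise : ∀ k → (basis x ↾ T) k ≡ (if eqb k x then + ι (T x) else + 0)
  pointwise k with k Finₚ.≟ x
  ... | no _ with T k
  ...   | true  = refl
  ...   | false = refl
  pointwise k | yes refl with T k
  ...   | true  = refl
  ...   | false = refl

sumOn-+basis : (T : Fin n → Bool) (a : Fin n → ℤ) (x : Fin n) →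
               sumOn T (λ k → a k + basis x k) ≡ sumOn T a + + ι (T x)
sumOn-+basis T a x = trans (sumOn-+ T a (basis x)) (cong (_+_ (sumOn T a)) (sumOn-basis T x))

sumOn-drop : (T : Fin n → Bool) {a : Fin n → ℤ} {x : Fin n} → a x ≡ + 0 →
             sumOn T a ≡ sumOn (T ∖ x) a
sumOn-drop T {a} {x} ax≡0 = sum-cong pointwise
  where
  pointwise : ∀ k → (a ↾ T) k ≡ (a ↾ (T ∖ x)) k
  pointwise k with k Finₚ.≟ x
  ... | no _ = ≡.sym (cong (λ b → if b then a k else + 0) (Boolₚ.∧-identityʳ (T k)))
  pointwise k | yes refl with T k
  ...   | true  = ax≡0
  ...   | false = refl

sumOn-inject₁ : (P : Fin (suc n) → Bool) (b : Fin (suc n) → ℤ) →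
                sumOn P b ≡ sumOn (P ∘ inject₁) (b ∘ inject₁) + (if P new then b new else + 0)
sumOn-inject₁ P b = sum-inject₁ (b ↾ P)

-- Closed neighbourhoods

nbhd : Adj n → (Fin n → Bool) → Fin n → Bool
nbhd A T j = T j ∨ anyFin (λ i → T i ∧ A i j)

⊆-nbhd : (A : Adj n) (T : Fin n → Bool) → T ⊆ nbhd A T
⊆-nbhd A T k = ∨-trueˡ _

nbhd-intro : (A : Adj n) (T : Fin n → Bool) {i j : Fin n} →
             T i ≡ true → A i j ≡ true → nbhd A T j ≡ true
nbhd-intro A T {i} {j} Ti Aij = ∨-trueʳ (T j) (any-intro (λ k → T k ∧ A k j) i (∧-true Ti Aij))

nbhd-elim : (A : Adj n) (T : Fin n → Bool) {j : Fin n} → nbhd A T j ≡ true →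
            T j ≡ true ⊎ ∃ λ i → T i ≡ true × A i j ≡ true
nbhd-elim A T {j} j∈N with ∨-true⁻ {T j} j∈N
... | inj₁ Tj = inj₁ Tj
... | inj₂ adj with any-elim (λ i → T i ∧ A i j) adj
...   | i , Ti∧Aij = inj₂ (i , ∧-true⁻ Ti∧Aij)

nbhd-cong : (A : Adj n) {T T′ : Fin n → Bool} → T ≗ T′ → nbhd A T ≗ nbhd A T′
nbhd-cong A T≗T′ j = cong₂ _∨_ (T≗T′ j) (any-cong (λ i → cong (_∧ A i j) (T≗T′ i)))
  where
  any-cong : ∀ {m} {f g : Fin m → Bool} → f ≗ g → anyFin f ≡ anyFin g
  any-cong {zero}  f≗g = refl
  any-cong {suc m} f≗g = cong₂ _∨_ (f≗g zero) (any-cong (f≗g ∘ suc))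

nbhd-mono : (A : Adj n) {T T′ : Fin n → Bool} → T ⊆ T′ → nbhd A T ⊆ nbhd A T′
nbhd-mono A {T} {T′} T⊆T′ k k∈N with nbhd-elim A T k∈N
... | inj₁ Tk             = ⊆-nbhd A T′ k (T⊆T′ k Tk)
... | inj₂ (i , Ti , Aik) = nbhd-intro A T′ (T⊆T′ i Ti) Aik

nbhd-∪ : (A : Adj n) (T T′ : Fin n → Bool) → nbhd A (T ∪ T′) ⊆ nbhd A T ∪ nbhd A T′
nbhd-∪ A T T′ k k∈N with nbhd-elim A (T ∪ T′) k∈N
... | inj₁ Tk∨T′k =
  [ ∨-trueˡ _ ∘ ⊆-nbhd A T k , ∨-trueʳ (nbhd A T k) ∘ ⊆-nbhd A T′ k ]′ (∨-true⁻ Tk∨T′k)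
... | inj₂ (i , Ti∨T′i , Aik) =
  [ (λ Ti → ∨-trueˡ _ (nbhd-intro A T Ti Aik)) , (λ T′i → ∨-trueʳ (nbhd A T k) (nbhd-intro A T′ T′i Aik)) ]′
    (∨-true⁻ Ti∨T′i)

nbhd-∩ : (A : Adj n) (T T′ : Fin n → Bool) → nbhd A (T ∩ T′) ⊆ nbhd A T ∩ nbhd A T′
nbhd-∩ A T T′ k k∈N = ∧-true (nbhd-mono A (∩⊆ˡ T T′) k k∈N) (nbhd-mono A (∩⊆ʳ T T′) k k∈N)

NeighbourhoodBound : Adj n → (Fin n → ℤ) → Set
NeighbourhoodBound {n} A a =
  ∀ (T : Fin n → Bool) x → T x ≡ true → sumOn T a < + countFin (nbhd A T)

count-tabulate : (g : Fin n → Bool) → ∣ tabulate g ∣ ≡ countFin g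
count-tabulate {zero}  g = refl
count-tabulate {suc n} g with g zero
... | true  = cong suc (count-tabulate (g ∘ suc))
... | false = count-tabulate (g ∘ suc)

Draconian⇒bound : {A : Adj n} {a : Fin n → ℤ} → Draconian A a → NeighbourhoodBound A a
Draconian⇒bound {A = A} {a} (_ , _ , bound) T x Tx =
  ≡.subst₂ _<_ (sumOn-congˡ a lookup-T) (cong +_ count-N) (bound (tabulate T) T≢∅)
  where
  lookup-T : lookup (tabulate T) ≗ T
  lookup-T = Vecₚ.lookup∘tabulate T
  T≢∅ : Nonempty (tabulate T)
  T≢∅ = x , Vecₚ.lookup⇒[]= x (tabulate T) (trans (lookup-T x) Tx)
  count-N : ∣ closedNbhd A (tabulate T) ∣ ≡ countFin (nbhd A T)
  count-N = trans (count-tabulate (nbhd A (lookup (tabulate T)))) (count-cong (nbhd-cong A lookup-T))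

bound⇒Draconian : {A : Adj n} {a : Fin n → ℤ} → (∀ i → + 0 ≤ a i) → sumFin a ≡ + (n ℕ.∸ 1) →
                  NeighbourhoodBound A a → Draconian A a
bound⇒Draconian {A = A} {a} nonneg total bound = nonneg , total , λ where
  S (x , x∈S) → subst (λ m → sumOn (lookup S) a < + m)
    (≡.sym (count-tabulate (nbhd A (lookup S)))) (bound (lookup S) x (Vecₚ.[]=⇒lookup x∈S))

Draconian-cong : {A : Adj n} {a b : Fin n → ℤ} → a ≗ b → Draconian A a → Draconian A b
Draconian-cong {A = A} {a} {b} a≗b (nonneg , total , bound) =
  (λ i → subst (+ 0 ≤_) (a≗b i) (nonneg i)) ,
  trans (≡.sym (sum-cong a≗b)) total ,
  λ S S≢∅ → subst (_< _) (sumOn-cong (lookup S) a≗b) (bound S S≢∅)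

bound-within : {A : Adj n} {a : Fin n → ℤ} → NeighbourhoodBound A a →
               {T Q : Fin n → Bool} → nbhd A T ⊆ Q → (x : Fin n) → Q x ≡ true →
               sumOn T a < + countFin Q
bound-within {A = A} {a} bound {T} {Q} N⊆Q x Qx with nonempty⊎empty T
... | inj₁ (y , Ty) = ℤₚ.<-≤-trans (bound T y Ty) (+≤+ (count-⊆ (nbhd A T) Q N⊆Q))
... | inj₂ empty    = subst (_< _) (≡.sym (sumOn-∅ T a empty)) (+<+ (count-pos Q x Qx))

-- Deleting and subdividing the edge uv

module Edge {N : ℕ} (A : Adj N) {u v : Fin N} (u≢v : u ≢ v) where

  A′ : Adj N
  A′ = deleteEdge A u v

  H : Adj (suc N)
  H = subdivide A u v

  N′ : (Fin N → Bool) → Fin N → Bool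
  N′ = nbhd A′

  -- The old vertices in the closed H-neighbourhood of T ∪ {N+1}.
  N⁺ : (Fin N → Bool) → Fin N → Bool
  N⁺ T = N′ T ∪ ⁅ u ⁆ ∪ ⁅ v ⁆

  nbhd-deleteEdge⁻ : (T : Fin N → Bool) {k : Fin N} → nbhd A T k ≡ true →
                     N′ T k ≡ true ⊎ (T u ≡ true × k ≡ v) ⊎ (T v ≡ true × k ≡ u)
  nbhd-deleteEdge⁻ T {k} k∈N with nbhd-elim A T k∈N
  ... | inj₁ Tk = inj₁ (⊆-nbhd A′ T k Tk)
  ... | inj₂ (i , Ti , Aik) with (eqb i u ∧ eqb k v) ∨ (eqb i v ∧ eqb k u) in isEdge
  ...   | false = inj₁ (nbhd-intro A′ T Ti (∧-true Aik (cong not isEdge)))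
  ...   | true  = [ inj₂ ∘ inj₁ ∘ endpoints , inj₂ ∘ inj₂ ∘ endpoints ]′ (∨-true⁻ isEdge)
    where
    endpoints : ∀ {x y} → eqb i x ∧ eqb k y ≡ true → T x ≡ true × k ≡ y
    endpoints i≡x∧k≡y with ∧-true⁻ {eqb i _} i≡x∧k≡y
    ... | i≡x , k≡y = subst (λ w → T w ≡ true) (eqb-sound i≡x) Ti , eqb-sound k≡y

  count-nbhd-deleteEdge : (T : Fin N → Bool) →
                          countFin (nbhd A T) ℕ.≤ countFin (N′ T) ℕ.+ ι (T u ∨ T v)
  count-nbhd-deleteEdge T with T u in Tu | T v in Tv
  ... | true  | _     = ℕₚ.≤-trans (count-≤-suc (nbhd A T) (N′ T) v onlyV) (ℕₚ.≤-reflexive (ℕₚ.+-comm 1 _))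
    where
    onlyV : ∀ k → nbhd A T k ≡ true → N′ T k ≡ true ⊎ k ≡ v
    onlyV k k∈N with nbhd-deleteEdge⁻ T k∈N
    ... | inj₁ k∈N′              = inj₁ k∈N′
    ... | inj₂ (inj₁ (_ , k≡v))  = inj₂ k≡v
    ... | inj₂ (inj₂ (_ , refl)) = inj₁ (⊆-nbhd A′ T u Tu)
  ... | false | true  = ℕₚ.≤-trans (count-≤-suc (nbhd A T) (N′ T) u onlyU) (ℕₚ.≤-reflexive (ℕₚ.+-comm 1 _))
    where
    onlyU : ∀ k → nbhd A T k ≡ true → N′ T k ≡ true ⊎ k ≡ u
    onlyU k k∈N with nbhd-deleteEdge⁻ T k∈N
    ... | inj₁ k∈N′             = inj₁ k∈N′
    ... | inj₂ (inj₁ (T∋u , _)) = ⊥-elim (true≢false T∋u Tu)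
    ... | inj₂ (inj₂ (_ , k≡u)) = inj₂ k≡u
  ... | false | false =
    ℕₚ.≤-trans (count-⊆ (nbhd A T) (N′ T) N⊆N′) (ℕₚ.≤-reflexive (≡.sym (ℕₚ.+-identityʳ _)))
    where
    N⊆N′ : nbhd A T ⊆ N′ T
    N⊆N′ k k∈N with nbhd-deleteEdge⁻ T k∈N
    ... | inj₁ k∈N′             = k∈N′
    ... | inj₂ (inj₁ (T∋u , _)) = ⊥-elim (true≢false T∋u Tu)
    ... | inj₂ (inj₂ (T∋v , _)) = ⊥-elim (true≢false T∋v Tv)

  u∈N⁺ : (T : Fin N → Bool) → N⁺ T u ≡ true
  u∈N⁺ T = ∨-trueʳ (N′ T u) (∨-trueˡ _ (eqb-refl u))

  v∈N⁺ : (T : Fin N → Bool) → N⁺ T v ≡ true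
  v∈N⁺ T = ∨-trueʳ (N′ T v) (∨-trueʳ (eqb v u) (eqb-refl v))

  N′⊆N⁺ : (T : Fin N → Bool) → N′ T ⊆ N⁺ T
  N′⊆N⁺ T k = ∨-trueˡ _

  nbhd⊆N⁺ : (T : Fin N → Bool) → nbhd A T ⊆ N⁺ T
  nbhd⊆N⁺ T k k∈N with nbhd-deleteEdge⁻ T k∈N
  ... | inj₁ k∈N′              = N′⊆N⁺ T k k∈N′
  ... | inj₂ (inj₁ (_ , refl)) = v∈N⁺ T
  ... | inj₂ (inj₂ (_ , refl)) = u∈N⁺ T

  count-N⁺ : (T : Fin N → Bool) → 2 ℕ.≤ countFin (N⁺ T)
  count-N⁺ T = count-two (N⁺ T) (u∈N⁺ T) (v∈N⁺ T) u≢v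

  N⁺-mono : {T T′ : Fin N → Bool} → T ⊆ T′ → N⁺ T ⊆ N⁺ T′
  N⁺-mono {T} {T′} T⊆T′ k k∈N⁺ with ∨-true⁻ {N′ T k} k∈N⁺
  ... | inj₁ k∈N′ = ∨-trueˡ _ (nbhd-mono A′ T⊆T′ k k∈N′)
  ... | inj₂ k∈uv = ∨-trueʳ (N′ T′ k) k∈uv

  N⁺-∪ : (T T′ : Fin N → Bool) → N⁺ (T ∪ T′) ⊆ N⁺ T ∪ N⁺ T′
  N⁺-∪ T T′ k k∈N⁺ with ∨-true⁻ {N′ (T ∪ T′) k} k∈N⁺
  ... | inj₂ k∈uv = ∨-trueˡ _ (∨-trueʳ (N′ T k) k∈uv)
  ... | inj₁ k∈N′ with ∨-true⁻ {N′ T k} (nbhd-∪ A′ T T′ k k∈N′)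
  ...   | inj₁ k∈N′T  = ∨-trueˡ _ (N′⊆N⁺ T k k∈N′T)
  ...   | inj₂ k∈N′T′ = ∨-trueʳ (N⁺ T k) (N′⊆N⁺ T′ k k∈N′T′)

  N⁺-∩ : (T T′ : Fin N → Bool) → N⁺ (T ∩ T′) ⊆ N⁺ T ∩ N⁺ T′
  N⁺-∩ T T′ k k∈N⁺ = ∧-true (N⁺-mono (∩⊆ˡ T T′) k k∈N⁺) (N⁺-mono (∩⊆ʳ T T′) k k∈N⁺)

  subdivide-old-old : ∀ a b → H (inject₁ a) (inject₁ b) ≡ A′ a b
  subdivide-old-old a b rewrite split-inject₁ a | split-inject₁ b = refl

  subdivide-old-new : ∀ a → H (inject₁ a) new ≡ (eqb a u ∨ eqb a v)
  subdivide-old-new a rewrite split-inject₁ a | split-new {N} = refl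

  subdivide-new-old : ∀ b → H new (inject₁ b) ≡ (eqb b u ∨ eqb b v)
  subdivide-new-old b rewrite split-inject₁ b | split-new {N} = refl

  module _ (P : Fin (suc N) → Bool) where

    N′⊆nbhd-subdivide : N′ (P ∘ inject₁) ⊆ nbhd H P ∘ inject₁
    N′⊆nbhd-subdivide k k∈N′ with nbhd-elim A′ (P ∘ inject₁) k∈N′
    ... | inj₁ Pk              = ⊆-nbhd H P (inject₁ k) Pk
    ... | inj₂ (i , Pi , A′ik) = nbhd-intro H P Pi (trans (subdivide-old-old i k) A′ik)

    count-nbhd-subdivide : countFin (N′ (P ∘ inject₁)) ℕ.+ ι (P (inject₁ u) ∨ P (inject₁ v))
                           ℕ.≤ countFin (nbhd H P)
    count-nbhd-subdivide =
      ℕₚ.≤-trans (ℕₚ.+-mono-≤ (count-⊆ _ _ N′⊆nbhd-subdivide) (ι-mono new∈N))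
                 (ℕₚ.≤-reflexive (≡.sym (count-inject₁ (nbhd H P))))
      where
      new∈N : P (inject₁ u) ∨ P (inject₁ v) ≡ true → nbhd H P new ≡ true
      new∈N Pu∨Pv with ∨-true⁻ {P (inject₁ u)} Pu∨Pv
      ... | inj₁ Pu = nbhd-intro H P Pu (trans (subdivide-old-new u) (∨-trueˡ _ (eqb-refl u)))
      ... | inj₂ Pv = nbhd-intro H P Pv (trans (subdivide-old-new v) (∨-trueʳ (eqb v u) (eqb-refl v)))

    count-nbhd-subdivide-new : P new ≡ true → countFin (N⁺ (P ∘ inject₁)) ℕ.+ 1 ℕ.≤ countFin (nbhd H P)
    count-nbhd-subdivide-new Pnew =
      ℕₚ.≤-trans (ℕₚ.+-mono-≤ (count-⊆ _ _ N⁺⊆nbhd) (ι-mono {true} λ _ → ⊆-nbhd H P new Pnew))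
                 (ℕₚ.≤-reflexive (≡.sym (count-inject₁ (nbhd H P))))
      where
      N⁺⊆nbhd : N⁺ (P ∘ inject₁) ⊆ nbhd H P ∘ inject₁
      N⁺⊆nbhd k k∈N⁺ with ∨-true⁻ {N′ (P ∘ inject₁) k} k∈N⁺
      ... | inj₁ k∈N′ = N′⊆nbhd-subdivide k k∈N′
      ... | inj₂ k∈uv = nbhd-intro H P Pnew (trans (subdivide-new-old k) k∈uv)

    count-nbhd≤count-nbhd-subdivide : countFin (nbhd A (P ∘ inject₁)) ℕ.≤ countFin (nbhd H P)
    count-nbhd≤count-nbhd-subdivide =
      ℕₚ.≤-trans (count-nbhd-deleteEdge (P ∘ inject₁)) count-nbhd-subdivide

pushTo : Fin n → (Fin n → ℤ) → Fin (suc n) → ℤ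
pushTo x c = shift (α c) (inject₁ x) new

∸1+1 : Fin n → + (n ℕ.∸ 1) + + 1 ≡ + n
∸1+1 {suc m} _ = cong +_ (ℕₚ.+-comm m 1)

module _ (c : Fin n → ℤ) where

  private
    eqb-inject₁ : ∀ (k x : Fin n) → eqb (inject₁ k) (inject₁ x) ≡ eqb k x
    eqb-inject₁ = eqb-injective inject₁ Finₚ.inject₁-injective

  γ′-old : (u k : Fin n) → γ′ u c (inject₁ k) ≡ c k - basis u k
  γ′-old u k rewrite split-inject₁ k | eqb-inject₁-new k | eqb-inject₁ k u =
    cong (_- basis u k) (ℤₚ.+-identityʳ (c k))

  γ′-new : (u : Fin n) → γ′ u c new ≡ + 2
  γ′-new u rewrite split-new {n} | eqb-refl (new {n}) | eqb-new-inject₁ u = refl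

  pushTo-old : (x k : Fin n) → pushTo x c (inject₁ k) ≡ c k + basis x k
  pushTo-old x k rewrite split-inject₁ k | eqb-inject₁-new k | eqb-inject₁ k x = ℤₚ.+-identityʳ _

  pushTo-new : (x : Fin n) → pushTo x c new ≡ + 0
  pushTo-new x rewrite split-new {n} | eqb-new-inject₁ x | eqb-refl (new {n}) = refl

  sumOn-γ′ : (u : Fin n) (P : Fin (suc n) → Bool) →
             sumOn P (γ′ u c) ≡ sumOn (P ∘ inject₁) c - + ι (P (inject₁ u)) + (if P new then + 2 else + 0)
  sumOn-γ′ u P = begin
    sumOn P (γ′ u c)
      ≡⟨ sumOn-inject₁ P (γ′ u c) ⟩
    sumOn (P ∘ inject₁) (γ′ u c ∘ inject₁) + (if P new then γ′ u c new else + 0)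
      ≡⟨ cong₂ _+_ (sumOn-cong (P ∘ inject₁) (γ′-old u))
                   (cong (λ t → if P new then t else + 0) (γ′-new u)) ⟩
    sumOn (P ∘ inject₁) (λ k → c k - basis u k) + (if P new then + 2 else + 0)
      ≡⟨ cong (_+ _) (trans (sumOn-- (P ∘ inject₁) c (basis u))
                            (cong (_-_ (sumOn (P ∘ inject₁) c)) (sumOn-basis (P ∘ inject₁) u))) ⟩
    sumOn (P ∘ inject₁) c - + ι (P (inject₁ u)) + (if P new then + 2 else + 0) ∎
    where open ≡.≡-Reasoning

  sumOn-pushTo : (x : Fin n) (P : Fin (suc n) → Bool) →
                 sumOn P (pushTo x c) ≡ sumOn (P ∘ inject₁) c + + ι (P (inject₁ x))
  sumOn-pushTo x P = begin
    sumOn P (pushTo x c)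
      ≡⟨ sumOn-inject₁ P (pushTo x c) ⟩
    sumOn (P ∘ inject₁) (pushTo x c ∘ inject₁) + (if P new then pushTo x c new else + 0)
      ≡⟨ cong₂ _+_ (sumOn-cong (P ∘ inject₁) (pushTo-old x)) (if-zero (P new) (pushTo-new x)) ⟩
    sumOn (P ∘ inject₁) (λ k → c k + basis x k) + + 0
      ≡⟨ ℤₚ.+-identityʳ _ ⟩
    sumOn (P ∘ inject₁) (λ k → c k + basis x k)
      ≡⟨ sumOn-+basis (P ∘ inject₁) c x ⟩
    sumOn (P ∘ inject₁) c + + ι (P (inject₁ x)) ∎
    where
    open ≡.≡-Reasoning
    if-zero : ∀ b {z} → z ≡ + 0 → (if b then z else + 0) ≡ + 0
    if-zero true  z≡0 = z≡0
    if-zero false _   = refl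

  module _ (total : sumFin c ≡ + (n ℕ.∸ 1)) (x : Fin n) where

    sum-γ′ : sumFin (γ′ x c) ≡ + n
    sum-γ′ = begin
      sumFin (γ′ x c)                                       ≡⟨ sum-inject₁ (γ′ x c) ⟩
      sumFin (γ′ x c ∘ inject₁) + γ′ x c new                ≡⟨ cong₂ _+_ (sum-cong (γ′-old x)) (γ′-new x) ⟩
      sumFin (λ k → c k - basis x k) + + 2                  ≡⟨ cong (_+ + 2) (sum-- c (basis x)) ⟩
      sumFin c - sumFin (basis x) + + 2                     ≡⟨ cong (λ s → s - sumFin (basis x) + + 2) total ⟩
      + (n ℕ.∸ 1) - sumFin (basis x) + + 2                  ≡⟨ cong (λ s → + (n ℕ.∸ 1) - s + + 2) (sumOn-⁅⁆ x (+ 1)) ⟩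
      + (n ℕ.∸ 1) - + 1 + + 2                               ≡⟨ -1+2 (+ (n ℕ.∸ 1)) ⟩
      + (n ℕ.∸ 1) + + 1                                     ≡⟨ ∸1+1 x ⟩
      + n                                                   ∎
      where
      open ≡.≡-Reasoning
      -1+2 : ∀ s → s - + 1 + + 2 ≡ s + + 1
      -1+2 = solve-∀

    sum-pushTo : sumFin (pushTo x c) ≡ + n
    sum-pushTo = begin
      sumFin (pushTo x c)                                   ≡⟨ sum-inject₁ (pushTo x c) ⟩
      sumFin (pushTo x c ∘ inject₁) + pushTo x c new        ≡⟨ cong₂ _+_ (sum-cong (pushTo-old x)) (pushTo-new x) ⟩
      sumFin (λ k → c k + basis x k) + + 0                  ≡⟨ ℤₚ.+-identityʳ _ ⟩
      sumFin (λ k → c k + basis x k)                        ≡⟨ sum-+ c (basis x) ⟩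
      sumFin c + sumFin (basis x)                           ≡⟨ cong₂ _+_ total (sumOn-⁅⁆ x (+ 1)) ⟩
      + (n ℕ.∸ 1) + + 1                                     ≡⟨ ∸1+1 x ⟩
      + n                                                   ∎
      where open ≡.≡-Reasoning

  module _ (nonneg : ∀ k → + 0 ≤ c k) where

    nonneg-pushTo : (x : Fin n) → ∀ i → + 0 ≤ pushTo x c i
    nonneg-pushTo x i with oldOrNew i
    ... | isNew = ℤₚ.≤-reflexive (≡.sym (pushTo-new x))
    ... | old k = subst (+ 0 ≤_) (≡.sym (pushTo-old x k)) (ℤₚ.+-mono-≤ (nonneg k) (basis≥0 (eqb k x)))
      where
      basis≥0 : ∀ b → + 0 ≤ (if b then + 1 else + 0)
      basis≥0 true  = +≤+ z≤n
      basis≥0 false = +≤+ z≤n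

    nonneg-γ′ : (u : Fin n) → + 1 ≤ c u → ∀ i → + 0 ≤ γ′ u c i
    nonneg-γ′ u cu≥1 i with oldOrNew i
    ... | isNew = subst (+ 0 ≤_) (≡.sym (γ′-new u)) (+≤+ z≤n)
    ... | old k rewrite γ′-old u k with k Finₚ.≟ u
    ...   | yes refl = ℤₚ.+-monoˡ-≤ (- + 1) cu≥1
    ...   | no _     = subst (+ 0 ≤_) (≡.sym (ℤₚ.+-identityʳ (c k))) (nonneg k)

γ′-injective : (u : Fin n) {c c′ : Fin n → ℤ} → γ′ u c ≗ γ′ u c′ → c ≗ c′
γ′-injective u {c} {c′} γ′≗γ′ k = ∙-cancelʳ (- basis u k) (c k) (c′ k)
  (trans (≡.sym (γ′-old c u k)) (trans (γ′≗γ′ (inject₁ k)) (γ′-old c′ u k)))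

pushTo-injective : (x : Fin n) {c c′ : Fin n → ℤ} → pushTo x c ≗ pushTo x c′ → c ≗ c′
pushTo-injective x {c} {c′} pushTo≗pushTo k = ∙-cancelʳ (basis x k) (c k) (c′ k)
  (trans (≡.sym (pushTo-old c x k)) (trans (pushTo≗pushTo (inject₁ k)) (pushTo-old c′ x k)))

γ′≢pushTo : (u x : Fin n) {c c′ : Fin n → ℤ} → γ′ u c new ≢ pushTo x c′ new
γ′≢pushTo u x {c} {c′} γ′≡pushTo
  with () ← trans (≡.sym (γ′-new c u)) (trans γ′≡pushTo (pushTo-new c′ x))

infixl 6 _⊕_
_⊕_ : ∀ {a b c d : ℤ} → a ≤ b → c ≤ d → a + c ≤ b + d
_⊕_ = ℤₚ.+-mono-≤

off-by-one : ∀ {L R : ℤ} → L ≤ R → L ≡ + 1 + R → ⊥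
off-by-one L≤R refl = ℤₚ.<-irrefl refl (ℤₚ.suc[i]≤j⇒i<j L≤R)

-- Draconian sequences of G : e

module Subdivision {N : ℕ} (A : Adj N) {u v : Fin N} (u≢v : u ≢ v) where

  open Edge A u≢v public
  open ℤₚ.≤-Reasoning

  subdivide-bound : (b : Fin (suc N) → ℤ) →
    (∀ P → P new ≡ true → sumOn P b < + countFin (nbhd H P)) →
    (∀ P y → P new ≡ false → P (inject₁ y) ≡ true → sumOn P b < + countFin (nbhd H P)) →
    NeighbourhoodBound H b
  subdivide-bound b with-new without-new P x Px with P new in Pnew
  ... | true  = with-new P Pnew
  ... | false with oldOrNew x
  ...   | old y = without-new P y Pnew Px
  ...   | isNew = ⊥-elim (true≢false Px Pnew)

  -- The draconian inequality of γ′(c) at T ∪ {N+1} can only fail in this way.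
  Obstruction : (Fin N → ℤ) → (Fin N → Bool) → Set
  Obstruction c T = + (countFin (N⁺ T) ℕ.+ 1) ≤ sumOn T c - + ι (T u) + + 2

  γ′-draconian : {c : Fin N → ℤ} → Draconian A c → + 1 ≤ c u → (∀ T → ¬ Obstruction c T) →
                 Draconian H (γ′ u c)
  γ′-draconian {c} dc@(nonneg , total , _) cu≥1 unobstructed =
    bound⇒Draconian {A = H} (nonneg-γ′ c nonneg u cu≥1) (sum-γ′ c total u)
      (subdivide-bound (γ′ u c) with-new without-new)
    where
    with-new : ∀ P → P new ≡ true → sumOn P (γ′ u c) < + countFin (nbhd H P)
    with-new P Pnew with sumOn P (γ′ u c) ℤₚ.<? + countFin (nbhd H P)
    ... | yes below = below
    ... | no ≮      = ⊥-elim (unobstructed (P ∘ inject₁) (begin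
      + (countFin (N⁺ (P ∘ inject₁)) ℕ.+ 1) ≤⟨ +≤+ (count-nbhd-subdivide-new P Pnew) ⟩
      + countFin (nbhd H P)                  ≤⟨ ℤₚ.≮⇒≥ ≮ ⟩
      sumOn P (γ′ u c)                       ≡⟨ sumOn-γ′ c u P ⟩
      sumOn (P ∘ inject₁) c - + ι (P (inject₁ u)) + (if P new then + 2 else + 0)
        ≡⟨ cong (λ b → sumOn (P ∘ inject₁) c - + ι (P (inject₁ u)) + (if b then + 2 else + 0)) Pnew ⟩
      sumOn (P ∘ inject₁) c - + ι (P (inject₁ u)) + + 2 ∎))
    without-new : ∀ P y → P new ≡ false → P (inject₁ y) ≡ true →
                  sumOn P (γ′ u c) < + countFin (nbhd H P)
    without-new P y Pnew Py = begin-strict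
      sumOn P (γ′ u c)                       ≡⟨ sumOn-γ′ c u P ⟩
      sumOn (P ∘ inject₁) c - + ι (P (inject₁ u)) + (if P new then + 2 else + 0)
        ≡⟨ cong (λ b → sumOn (P ∘ inject₁) c - + ι (P (inject₁ u)) + (if b then + 2 else + 0)) Pnew ⟩
      sumOn (P ∘ inject₁) c - + ι (P (inject₁ u)) + + 0 ≡⟨ ℤₚ.+-identityʳ _ ⟩
      sumOn (P ∘ inject₁) c - + ι (P (inject₁ u)) ≤⟨ ℤₚ.i-j≤i _ _ ⟩
      sumOn (P ∘ inject₁) c                  <⟨ Draconian⇒bound dc (P ∘ inject₁) y Py ⟩
      + countFin (nbhd A (P ∘ inject₁))      ≤⟨ +≤+ (count-nbhd≤count-nbhd-subdivide P) ⟩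
      + countFin (nbhd H P)                  ∎

  module _ {c : Fin N → ℤ} (x : Fin N) (P : Fin (suc N) → Bool) where

    private
      T : Fin N → Bool
      T = P ∘ inject₁

    pushTo-bound-new : NeighbourhoodBound A c → P new ≡ true →
                       sumOn P (pushTo x c) < + countFin (nbhd H P)
    pushTo-bound-new bound Pnew = begin-strict
      sumOn P (pushTo x c)        ≡⟨ sumOn-pushTo c x P ⟩
      sumOn T c + + ι (T x)       ≤⟨ ℤₚ.+-monoʳ-≤ (sumOn T c) (ι≤1 (T x)) ⟩
      sumOn T c + + 1             <⟨ ℤₚ.+-monoˡ-< (+ 1) (bound-within bound (nbhd⊆N⁺ T) u (u∈N⁺ T)) ⟩
      + (countFin (N⁺ T) ℕ.+ 1)   ≤⟨ +≤+ (count-nbhd-subdivide-new P Pnew) ⟩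
      + countFin (nbhd H P)       ∎

    pushTo-bound-deleteEdge : x ≡ u ⊎ x ≡ v → sumOn T c < + countFin (N′ T) →
                              sumOn P (pushTo x c) < + countFin (nbhd H P)
    pushTo-bound-deleteEdge x∈uv below = begin-strict
      sumOn P (pushTo x c)                    ≡⟨ sumOn-pushTo c x P ⟩
      sumOn T c + + ι (T x)                   <⟨ ℤₚ.+-mono-<-≤ below (+≤+ (ι-mono Tx⇒Tu∨Tv)) ⟩
      + (countFin (N′ T) ℕ.+ ι (T u ∨ T v))   ≤⟨ +≤+ (count-nbhd-subdivide P) ⟩
      + countFin (nbhd H P)                   ∎
      where
      Tx⇒Tu∨Tv : T x ≡ true → T u ∨ T v ≡ true
      Tx⇒Tu∨Tv = [ (λ { refl → ∨-trueˡ _ }) , (λ { refl → ∨-trueʳ (T u) }) ]′ x∈uv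

    pushTo-bound-absent : T x ≡ false → sumOn T c < + countFin (nbhd A T) →
                          sumOn P (pushTo x c) < + countFin (nbhd H P)
    pushTo-bound-absent Tx below = begin-strict
      sumOn P (pushTo x c)    ≡⟨ sumOn-pushTo c x P ⟩
      sumOn T c + + ι (T x)   ≡⟨ cong (λ b → sumOn T c + + ι b) Tx ⟩
      sumOn T c + + 0         ≡⟨ ℤₚ.+-identityʳ _ ⟩
      sumOn T c               <⟨ below ⟩
      + countFin (nbhd A T)   ≤⟨ +≤+ (count-nbhd≤count-nbhd-subdivide P) ⟩
      + countFin (nbhd H P)   ∎

  pushTo-v-draconian : {c : Fin N → ℤ} → Draconian A c → Draconian A′ c → Draconian H (pushTo v c)
  pushTo-v-draconian {c} dc@(nonneg , total , _) dc′ =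
    bound⇒Draconian {A = H} (nonneg-pushTo c nonneg v) (sum-pushTo c total v)
      (subdivide-bound (pushTo v c) (λ P → pushTo-bound-new v P (Draconian⇒bound dc))
      (λ P y _ Py → pushTo-bound-deleteEdge v P (inj₂ refl) (Draconian⇒bound dc′ (P ∘ inject₁) y Py)))

  Tight : (Fin N → ℤ) → (Fin N → Bool) → Set
  Tight c T = + countFin (N′ T) ≤ sumOn T c

  draconian-unless-tight : {c : Fin N → ℤ} → Draconian A c →
                           (∀ T y → T y ≡ true → Tight c T → ⊥) → Draconian A′ c
  draconian-unless-tight {c} (nonneg , total , _) never-tight =
    bound⇒Draconian {A = A′} nonneg total below-or-tight
    where
    below-or-tight : ∀ T y → T y ≡ true → sumOn T c < + countFin (N′ T)
    below-or-tight T y Ty with sumOn T c ℤₚ.<? + countFin (N′ T)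
    ... | yes below = below
    ... | no ≮      = ⊥-elim (never-tight T y Ty (ℤₚ.≮⇒≥ ≮))

  module TightAtU {c : Fin N → ℤ} (dc : Draconian A c)
                  {T : Fin N → Bool} (Tu : T u ≡ true) (tight : Tight c T) where

    private
      bound : NeighbourhoodBound A c
      bound = Draconian⇒bound dc
      +2≡1+_+1 : ∀ s → s + + 2 ≡ + 1 + s + + 1
      +2≡1+_+1 = solve-∀

    v∉N′ : N′ T v ≡ false
    v∉N′ with N′ T v in v∈N′
    ... | false = refl
    ... | true  = ⊥-elim (ℤₚ.<-irrefl refl (begin-strict
      sumOn T c               <⟨ bound T u Tu ⟩
      + countFin (nbhd A T)   ≤⟨ +≤+ (count-⊆ (nbhd A T) (N′ T) N⊆N′) ⟩
      + countFin (N′ T)       ≤⟨ tight ⟩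
      sumOn T c               ∎))
      where
      N⊆N′ : nbhd A T ⊆ N′ T
      N⊆N′ k k∈N with nbhd-deleteEdge⁻ T k∈N
      ... | inj₁ k∈N′              = k∈N′
      ... | inj₂ (inj₁ (_ , refl)) = v∈N′
      ... | inj₂ (inj₂ (_ , refl)) = ⊆-nbhd A′ T u Tu

    cu≥1 : (∀ k → + 0 ≤ c k) → + 1 ≤ c u
    cu≥1 nonneg with + 1 ℤₚ.≤? c u
    ... | yes cu≥1 = cu≥1
    ... | no  cu≱1 = ⊥-elim (ℤₚ.<-irrefl refl (begin-strict
      sumOn T c           ≡⟨ sumOn-drop T cu≡0 ⟩
      sumOn (T ∖ u) c     <⟨ bound-within bound nbhd-T∖u⊆N′ u (⊆-nbhd A′ T u Tu) ⟩
      + countFin (N′ T)   ≤⟨ tight ⟩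
      sumOn T c           ∎))
      where
      cu≡0 : c u ≡ + 0
      cu≡0 with c u | nonneg u
      ... | + zero    | _ = refl
      ... | + suc _   | _ = ⊥-elim (cu≱1 (+≤+ (s≤s z≤n)))
      u∉T∖u : (T ∖ u) u ≡ false
      u∉T∖u rewrite eqb-refl u = Boolₚ.∧-zeroʳ (T u)
      nbhd-T∖u⊆N′ : nbhd A (T ∖ u) ⊆ N′ T
      nbhd-T∖u⊆N′ k k∈N with nbhd-deleteEdge⁻ (T ∖ u) k∈N
      ... | inj₁ k∈N′            = nbhd-mono A′ (λ j → proj₁ ∘ ∧-true⁻ {T j}) k k∈N′
      ... | inj₂ (inj₁ (u∈ , _)) = ⊥-elim (true≢false u∈ u∉T∖u)
      ... | inj₂ (inj₂ (v∈ , _)) = ⊥-elim (true≢false (⊆-nbhd A′ T v (proj₁ (∧-true⁻ {T v} v∈))) v∉N′)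

    count-N⁺≤count-N′+1 : countFin (N⁺ T) ℕ.≤ countFin (N′ T) ℕ.+ 1
    count-N⁺≤count-N′+1 =
      ℕₚ.≤-trans (count-≤-suc (N⁺ T) (N′ T) v N⁺⊆N′∪v) (ℕₚ.≤-reflexive (ℕₚ.+-comm 1 _))
      where
      N⁺⊆N′∪v : ∀ k → N⁺ T k ≡ true → N′ T k ≡ true ⊎ k ≡ v
      N⁺⊆N′∪v k k∈N⁺ with ∨-true⁻ {N′ T k} k∈N⁺
      ... | inj₁ k∈N′ = inj₁ k∈N′
      ... | inj₂ k∈uv with ∨-true⁻ {eqb k u} k∈uv
      ...   | inj₁ k≡u = inj₁ (subst (λ w → N′ T w ≡ true) (≡.sym (eqb-sound k≡u)) (⊆-nbhd A′ T u Tu))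
      ...   | inj₂ k≡v = inj₂ (eqb-sound k≡v)

    -- The lost 1 when u ∉ T′ is recovered from v, which lies in N⁺ T ∩ N⁺ T′ but not in N_G[T ∩ T′].
    sumOn-∩+2≤ : ∀ T′ → sumOn (T ∩ T′) c + + 2 ≤ + countFin (N⁺ T ∩ N⁺ T′) + + ι (T′ u)
    sumOn-∩+2≤ T′ with T′ u in T′u
    ... | true  = begin
      sumOn I c + + 2         ≡⟨ +2≡1+_+1 (sumOn I c) ⟩
      + 1 + sumOn I c + + 1   ≤⟨ ℤₚ.+-monoˡ-≤ (+ 1) (ℤₚ.i<j⇒suc[i]≤j
                                   (bound-within bound nbhdI⊆J u (∧-true (u∈N⁺ T) (u∈N⁺ T′)))) ⟩
      + countFin J + + 1      ∎
      where
      I J : Fin N → Bool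
      I = T ∩ T′
      J = N⁺ T ∩ N⁺ T′
      nbhdI⊆J : nbhd A I ⊆ J
      nbhdI⊆J k k∈N = N⁺-∩ T T′ k (nbhd⊆N⁺ I k k∈N)
    ... | false with nonempty⊎empty (T ∩ T′)
    ...   | inj₂ empty = begin
      sumOn (T ∩ T′) c + + 2            ≡⟨ cong (_+ + 2) (sumOn-∅ (T ∩ T′) c empty) ⟩
      + 2                               ≤⟨ +≤+ (count-two (N⁺ T ∩ N⁺ T′) (∧-true (u∈N⁺ T) (u∈N⁺ T′))
                                                   (∧-true (v∈N⁺ T) (v∈N⁺ T′)) u≢v) ⟩
      + countFin (N⁺ T ∩ N⁺ T′)         ≡⟨ ℤₚ.+-identityʳ _ ⟨
      + countFin (N⁺ T ∩ N⁺ T′) + + 0   ∎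
    ...   | inj₁ (y , Iy) = begin
      sumOn I c + + 2                ≡⟨ +2≡1+_+1 (sumOn I c) ⟩
      + 1 + sumOn I c + + 1          ≤⟨ ℤₚ.+-monoˡ-≤ (+ 1) (ℤₚ.i<j⇒suc[i]≤j (bound I y Iy)) ⟩
      + countFin (nbhd A I) + + 1    ≤⟨ +≤+ (ℕₚ.≤-trans (ℕₚ.≤-reflexive (ℕₚ.+-comm _ 1))
                                          (count-⊂ (nbhd A I) J nbhdI⊆J v (∧-true (v∈N⁺ T) (v∈N⁺ T′)) v∉nbhdI)) ⟩
      + countFin J                   ≡⟨ ℤₚ.+-identityʳ _ ⟨
      + countFin J + + 0             ∎
      where
      I J : Fin N → Bool
      I = T ∩ T′
      J = N⁺ T ∩ N⁺ T′
      nbhdI⊆J : nbhd A I ⊆ J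
      nbhdI⊆J k k∈N = N⁺-∩ T T′ k (nbhd⊆N⁺ I k k∈N)
      v∉nbhdI : nbhd A I v ≡ false
      v∉nbhdI with nbhd A I v in v∈N
      ... | false = refl
      ... | true with nbhd-deleteEdge⁻ I v∈N
      ...   | inj₁ v∈N′             = ⊥-elim (true≢false (nbhd-mono A′ (∩⊆ˡ T T′) v v∈N′) v∉N′)
      ...   | inj₂ (inj₁ (u∈I , _)) = ⊥-elim (true≢false (∩⊆ʳ T T′ u u∈I) T′u)
      ...   | inj₂ (inj₂ (_ , v≡u)) = ⊥-elim (u≢v (≡.sym v≡u))

    unobstructed : ∀ T′ → ¬ Obstruction c T′
    unobstructed T′ obstruction =
      off-by-one (1+U≤N⁺U ⊕ ∪-∩ ⊕ +≤+ count-N⁺≤count-N′+1 ⊕ sumOn-∩+2≤ T′ ⊕ tight ⊕ obstruction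
                  ⊕ ℤₚ.≤-reflexive (≡.sym (sumOn-∪-∩ T T′ c)))
        (rearrange (sumOn U c) (sumOn I c) (sumOn T c) (sumOn T′ c) (+ countFin (N⁺ U)) (+ countFin J)
                   (+ countFin (N⁺ T)) (+ countFin (N⁺ T′)) (+ countFin (N′ T)) (+ ι (T′ u)))
      where
      U I J : Fin N → Bool
      U = T ∪ T′
      I = T ∩ T′
      J = N⁺ T ∩ N⁺ T′
      rearrange : ∀ cU cI cT cT′ nU nJ nT nT′ n′T ιu →
        + 1 + cU + (nU + nJ) + nT + (cI + + 2) + n′T + (nT′ + + 1) + (cT + cT′) ≡
        + 1 + (nU + (nT + nT′) + (n′T + + 1) + (nJ + ιu) + cT + (cT′ - ιu + + 2) + (cU + cI))
      rearrange = solve-∀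
      1+U≤N⁺U : + 1 + sumOn U c ≤ + countFin (N⁺ U)
      1+U≤N⁺U = ℤₚ.i<j⇒suc[i]≤j (bound-within bound (nbhd⊆N⁺ U) u (u∈N⁺ U))
      ∪-∩ : + countFin (N⁺ U) + + countFin J ≤ + countFin (N⁺ T) + + countFin (N⁺ T′)
      ∪-∩ = +≤+ (ℕₚ.≤-trans (ℕₚ.+-monoˡ-≤ (countFin J) (count-⊆ (N⁺ U) (N⁺ T ∪ N⁺ T′) (N⁺-∪ T T′)))
                            (ℕₚ.≤-reflexive (count-∪-∩ (N⁺ T) (N⁺ T′))))

  tight⇒γ′-draconian : {c : Fin N → ℤ} → Draconian A c → {T : Fin N → Bool} → T u ≡ true → Tight c T →
                       Draconian H (γ′ u c)
  tight⇒γ′-draconian dc@(nonneg , _) Tu tight = γ′-draconian dc (cu≥1 nonneg) unobstructed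
    where open TightAtU dc Tu tight

  pushTo-u-draconian : {c : Fin N → ℤ} → Draconian A c → ¬ Draconian H (γ′ u c) → Draconian H (pushTo u c)
  pushTo-u-draconian {c} dc@(nonneg , total , _) γ′∉D =
    bound⇒Draconian {A = H} (nonneg-pushTo c nonneg u) (sum-pushTo c total u)
      (subdivide-bound (pushTo u c) (λ P → pushTo-bound-new u P (Draconian⇒bound dc)) without-new)
    where
    without-new : ∀ P y → P new ≡ false → P (inject₁ y) ≡ true →
                  sumOn P (pushTo u c) < + countFin (nbhd H P)
    without-new P y _ Py with P (inject₁ u) in Pu
    ... | false = pushTo-bound-absent u P Pu (Draconian⇒bound dc (P ∘ inject₁) y Py)
    ... | true with sumOn (P ∘ inject₁) c ℤₚ.<? + countFin (N′ (P ∘ inject₁))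
    ...   | yes below = pushTo-bound-deleteEdge u P (inj₁ refl) below
    -- A tight set containing u would have put γ′(c) into D(G : e).
    ...   | no  ≮     = ⊥-elim (γ′∉D (tight⇒γ′-draconian dc Pu (ℤₚ.≮⇒≥ ≮)))

  module _ {c : Fin N → ℤ} (bound′ : NeighbourhoodBound A′ c)
           {T : Fin N → Bool} (obstruction : Obstruction c T) where

    obstruction-nonempty : ∃ λ y → T y ≡ true
    obstruction-nonempty with nonempty⊎empty T
    ... | inj₁ nonempty = nonempty
    ... | inj₂ empty    = ⊥-elim (off-by-one (begin
      + 3                            ≤⟨ +≤+ (ℕₚ.+-monoˡ-≤ 1 (count-N⁺ T)) ⟩
      + (countFin (N⁺ T) ℕ.+ 1)      ≤⟨ obstruction ⟩
      sumOn T c - + ι (T u) + + 2    ≡⟨ cong₂ (λ s b → s - + ι b + + 2) (sumOn-∅ T c empty) (empty u) ⟩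
      + 2                            ∎) refl)

    obstruction-∌u : T u ≡ false
    obstruction-∌u with T u in Tu | obstruction-nonempty
    ... | false | _        = refl
    ... | true  | (y , Ty) = ⊥-elim (ℤₚ.<-irrefl refl (begin-strict
      + (countFin (N⁺ T) ℕ.+ 1)      ≤⟨ obstruction ⟩
      sumOn T c - + ι (T u) + + 2    ≡⟨ cong (λ b → sumOn T c - + ι b + + 2) Tu ⟩
      sumOn T c - + 1 + + 2          ≡⟨ -1+2 (sumOn T c) ⟩
      sumOn T c + + 1                <⟨ ℤₚ.+-monoˡ-< (+ 1) (bound′ T y Ty) ⟩
      + (countFin (N′ T) ℕ.+ 1)      ≤⟨ +≤+ (ℕₚ.+-monoˡ-≤ 1 (count-⊆ (N′ T) (N⁺ T) (N′⊆N⁺ T))) ⟩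
      + (countFin (N⁺ T) ℕ.+ 1)      ∎))
      where
      -1+2 : ∀ s → s - + 1 + + 2 ≡ s + + 1
      -1+2 = solve-∀

    obstruction-N⁺⊆N′ : N⁺ T ⊆ N′ T
    obstruction-N⁺⊆N′ z z∈N⁺ with N′ T z in z∈N′ | obstruction-nonempty
    ... | true  | _        = refl
    ... | false | (y , Ty) = ⊥-elim (ℤₚ.<-irrefl (cong +_ (≡.sym (ℕₚ.+-suc _ 1))) (begin-strict
      + (suc (countFin (N′ T)) ℕ.+ 1)
        ≤⟨ +≤+ (ℕₚ.+-monoˡ-≤ 1 (count-⊂ (N′ T) (N⁺ T) (N′⊆N⁺ T) z (∨-trueʳ (N′ T z) z∈N⁺) z∈N′)) ⟩
      + (countFin (N⁺ T) ℕ.+ 1)        ≤⟨ obstruction ⟩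
      sumOn T c - + ι (T u) + + 2      ≡⟨ cong (λ b → sumOn T c - + ι b + + 2) obstruction-∌u ⟩
      sumOn T c - + 0 + + 2            ≡⟨ cong (_+ + 2) (ℤₚ.+-identityʳ (sumOn T c)) ⟩
      sumOn T c + + 2                  <⟨ ℤₚ.+-monoˡ-< (+ 2) (bound′ T y Ty) ⟩
      + countFin (N′ T) + + 2          ∎))

  module Exchange {c c′ : Fin N → ℤ} (bound : NeighbourhoodBound A c) (bound′ : NeighbourhoodBound A′ c′)
                  (exchange : ∀ k → c k + basis u k ≡ c′ k + basis v k)
                  {T : Fin N → Bool} {y : Fin N} (Ty : T y ≡ true) (tight : Tight c T) where

    sumOn-exchange : ∀ X → sumOn X c + + ι (X u) ≡ sumOn X c′ + + ι (X v)
    sumOn-exchange X =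
      trans (≡.sym (sumOn-+basis X c u)) (trans (sumOn-cong X exchange) (sumOn-+basis X c′ v))

    T∌u : T u ≡ false
    T∌u with T u in Tu
    ... | false = refl
    ... | true  = ⊥-elim (ℤₚ.<-irrefl refl (begin-strict
      sumOn T c + + 1              ≡⟨ cong (λ b → sumOn T c + + ι b) Tu ⟨
      sumOn T c + + ι (T u)        ≡⟨ sumOn-exchange T ⟩
      sumOn T c′ + + ι (T v)       ≤⟨ ℤₚ.+-monoʳ-≤ (sumOn T c′) (ι≤1 (T v)) ⟩
      sumOn T c′ + + 1             <⟨ ℤₚ.+-monoˡ-< (+ 1) (bound′ T y Ty) ⟩
      + countFin (N′ T) + + 1      ≤⟨ ℤₚ.+-monoˡ-≤ (+ 1) tight ⟩
      sumOn T c + + 1              ∎))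

    T∋v : T v ≡ true
    T∋v with T v in Tv
    ... | true  = refl
    ... | false = ⊥-elim (ℤₚ.<-irrefl refl (begin-strict
      sumOn T c                                  <⟨ bound T y Ty ⟩
      + countFin (nbhd A T)                      ≤⟨ +≤+ (count-nbhd-deleteEdge T) ⟩
      + (countFin (N′ T) ℕ.+ ι (T u ∨ T v))      ≡⟨ cong₂ (λ a b → + (countFin (N′ T) ℕ.+ ι (a ∨ b))) T∌u Tv ⟩
      + (countFin (N′ T) ℕ.+ 0)                  ≡⟨ cong +_ (ℕₚ.+-identityʳ _) ⟩
      + countFin (N′ T)                          ≤⟨ tight ⟩
      sumOn T c                                  ∎))

    sumOn-∩+1≤ : ∀ T′ → N′ T′ v ≡ true →
                 sumOn (T ∩ T′) c + + 1 ≤ + countFin (N′ T ∩ N′ T′) + + ι (T′ v)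
    sumOn-∩+1≤ T′ v∈N′T′ with nonempty⊎empty (T ∩ T′)
    ... | inj₂ empty = begin
      sumOn (T ∩ T′) c + + 1                 ≡⟨ cong (_+ + 1) (sumOn-∅ (T ∩ T′) c empty) ⟩
      + 1                                    ≤⟨ +≤+ (count-pos (N′ T ∩ N′ T′) v (∧-true (⊆-nbhd A′ T v T∋v) v∈N′T′)) ⟩
      + countFin (N′ T ∩ N′ T′)              ≤⟨ ℤₚ.i≤i+j _ _ ⟩
      + countFin (N′ T ∩ N′ T′) + + ι (T′ v) ∎
    ... | inj₁ (z , Xz) = begin
      sumOn X c + + 1                          ≡⟨ ℤₚ.+-comm (sumOn X c) (+ 1) ⟩
      + 1 + sumOn X c                          ≤⟨ ℤₚ.i<j⇒suc[i]≤j (bound X z Xz) ⟩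
      + countFin (nbhd A X)                    ≤⟨ +≤+ (count-nbhd-deleteEdge X) ⟩
      + (countFin (N′ X) ℕ.+ ι (X u ∨ X v))    ≡⟨ cong (λ b → + (countFin (N′ X) ℕ.+ ι b)) Xu∨Xv ⟩
      + (countFin (N′ X) ℕ.+ ι (T′ v))         ≤⟨ +≤+ (ℕₚ.+-monoˡ-≤ (ι (T′ v)) (count-⊆ (N′ X) _ (nbhd-∩ A′ T T′))) ⟩
      + countFin (N′ T ∩ N′ T′) + + ι (T′ v)   ∎
      where
      X : Fin N → Bool
      X = T ∩ T′
      Xu∨Xv : X u ∨ X v ≡ T′ v
      Xu∨Xv rewrite T∌u | T∋v = refl

    unobstructed : ∀ T′ → ¬ Obstruction c′ T′
    unobstructed T′ obstruction =
      off-by-one (1+U≤N′U ⊕ ∪-∩ ⊕ sumOn-∩+1≤ T′ (N⁺T′⊆N′T′ v (v∈N⁺ T′)) ⊕ tight ⊕ N′T′≤N⁺T′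
                  ⊕ obstruction ⊕ ℤₚ.≤-reflexive (≡.sym (sumOn-exchange T′))
                  ⊕ ℤₚ.≤-reflexive (≡.sym (sumOn-∪-∩ T T′ c)))
        (rearrange (sumOn U c) (sumOn X c) (sumOn T c) (sumOn T′ c) (sumOn T′ c′) (+ countFin (N′ U))
                   (+ countFin I) (+ countFin (N′ T)) (+ countFin (N′ T′)) (+ countFin (N⁺ T′))
                   (+ ι (T′ u)) (+ ι (T′ v)))
      where
      U X I : Fin N → Bool
      U = T ∪ T′
      X = T ∩ T′
      I = N′ T ∩ N′ T′
      rearrange : ∀ cU cX cT cT′ c′T′ n′U nI n′T n′T′ nT′ ιu ιv →
        + 1 + cU + (n′U + nI) + (cX + + 1) + n′T + n′T′ + (nT′ + + 1) + (c′T′ + ιv) + (cT + cT′) ≡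
        + 1 + (n′U + (n′T + n′T′) + (nI + ιv) + cT + nT′ + (c′T′ - ιu + + 2) + (cT′ + ιu) + (cU + cX))
      rearrange = solve-∀
      N⁺T′⊆N′T′ : N⁺ T′ ⊆ N′ T′
      N⁺T′⊆N′T′ = obstruction-N⁺⊆N′ bound′ obstruction
      N′T′⊆N′U : N′ T′ ⊆ N′ U
      N′T′⊆N′U = nbhd-mono A′ (λ k → ∨-trueʳ (T k))
      nbhdU⊆N′U : nbhd A U ⊆ N′ U
      nbhdU⊆N′U k k∈N with nbhd-deleteEdge⁻ U k∈N
      ... | inj₁ k∈N′              = k∈N′
      ... | inj₂ (inj₁ (_ , refl)) = N′T′⊆N′U v (N⁺T′⊆N′T′ v (v∈N⁺ T′))
      ... | inj₂ (inj₂ (_ , refl)) = N′T′⊆N′U u (N⁺T′⊆N′T′ u (u∈N⁺ T′))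
      1+U≤N′U : + 1 + sumOn U c ≤ + countFin (N′ U)
      1+U≤N′U = ℤₚ.i<j⇒suc[i]≤j (bound-within bound nbhdU⊆N′U u (N′T′⊆N′U u (N⁺T′⊆N′T′ u (u∈N⁺ T′))))
      ∪-∩ : + countFin (N′ U) + + countFin I ≤ + countFin (N′ T) + + countFin (N′ T′)
      ∪-∩ = +≤+ (ℕₚ.≤-trans (ℕₚ.+-monoˡ-≤ (countFin I) (count-⊆ (N′ U) (N′ T ∪ N′ T′) (nbhd-∪ A′ T T′)))
                            (ℕₚ.≤-reflexive (count-∪-∩ (N′ T) (N′ T′))))
      N′T′≤N⁺T′ : + countFin (N′ T′) ≤ + countFin (N⁺ T′)
      N′T′≤N⁺T′ = +≤+ (count-⊆ (N′ T′) (N⁺ T′) (N′⊆N⁺ T′))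

  exchange-γ′-draconian : {c c′ : Fin N → ℤ} → Draconian A c → Draconian A c′ → Draconian A′ c′ →
                          (∀ k → c k + basis u k ≡ c′ k + basis v k) →
                          {T : Fin N → Bool} {y : Fin N} → T y ≡ true → Tight c T →
                          Draconian H (γ′ u c′)
  exchange-γ′-draconian {c} {c′} dc@(nonneg , _) dc′ dc′∖e exchange Ty tight =
    γ′-draconian dc′ c′u≥1 unobstructed
    where
    open Exchange (Draconian⇒bound dc) (Draconian⇒bound dc′∖e) exchange Ty tight
    c′u≥1 : + 1 ≤ c′ u
    c′u≥1 = begin
      + 1                  ≤⟨ ℤₚ.+-monoˡ-≤ (+ 1) (nonneg u) ⟩
      c u + + 1            ≡⟨ cong (λ b → c u + (if b then + 1 else + 0)) (eqb-refl u) ⟨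
      c u + basis u u      ≡⟨ exchange u ⟩
      c′ u + basis v u     ≡⟨ cong (λ b → c′ u + (if b then + 1 else + 0)) (eqb-false u≢v) ⟩
      c′ u + + 0           ≡⟨ ℤₚ.+-identityʳ (c′ u) ⟩
      c′ u                 ∎

  pushTo-u≢pushTo-v : {c c′ : Fin N → ℤ} → Draconian A c → Draconian A c′ →
                      ¬ Draconian A′ c → Draconian A′ c′ → ¬ Draconian H (γ′ u c′) →
                      pushTo u c ≗ pushTo v c′ → ⊥
  pushTo-u≢pushTo-v {c} {c′} dc dc′ c∉D′ c′∈D′ γ′c′∉D pushed =
    c∉D′ (draconian-unless-tight dc λ T y Ty tight →
            γ′c′∉D (exchange-γ′-draconian dc dc′ c′∈D′ exchange Ty tight))
    where
    exchange : ∀ k → c k + basis u k ≡ c′ k + basis v k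
    exchange k = trans (≡.sym (pushTo-old c u k)) (trans (pushed (inject₁ k)) (pushTo-old c′ v k))

-- The map γ

module Gamma {N : ℕ} (G : SimpleGraph N) {u v : Fin N} (u≢v : u ≢ v) where

  open Subdivision (adj G) u≢v

  data γ-Case (c : Fin N → ℤ) (γc : Fin (suc N) → ℤ) : Set where
    subdivided : Draconian H (γ′ u c) → γc ≗ γ′ u c → γ-Case c γc
    pushed-u   : ¬ Draconian H (γ′ u c) → ¬ Draconian A′ c → γc ≗ pushTo u c → γ-Case c γc
    pushed-v   : ¬ Draconian H (γ′ u c) → Draconian A′ c → γc ≗ pushTo v c → γ-Case c γc

  γ-case : (c : Fin N → ℤ) → γ-Case c (γ G u v c)
  γ-case c with draconian? (subdivide (adj G) u v) (γ′ u c)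
  ... | yes γ′∈D = subdivided γ′∈D λ _ → refl
  ... | no  γ′∉D with draconian? (deleteEdge (adj G) u v) c
  ...   | no  c∉D′ = pushed-u γ′∉D c∉D′ λ _ → refl
  ...   | yes c∈D′ = pushed-v γ′∉D c∈D′ λ _ → refl

  γ-draconian : (c : Fin N → ℤ) → Draconian (adj G) c → Draconian H (γ G u v c)
  γ-draconian c dc with γ-case c
  ... | subdivided γ′∈D γ≗   = Draconian-cong {A = H} (≡.sym ∘ γ≗) γ′∈D
  ... | pushed-u γ′∉D _ γ≗   = Draconian-cong {A = H} (≡.sym ∘ γ≗) (pushTo-u-draconian dc γ′∉D)
  ... | pushed-v _ c∈D′ γ≗   = Draconian-cong {A = H} (≡.sym ∘ γ≗) (pushTo-v-draconian dc c∈D′)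

  private
    relate : {c c′ : Fin N → ℤ} {f f′ : Fin (suc N) → ℤ} →
             γ G u v c ≗ γ G u v c′ → γ G u v c ≗ f → γ G u v c′ ≗ f′ → f ≗ f′
    relate γ≗γ e e′ i = trans (≡.sym (e i)) (trans (γ≗γ i) (e′ i))

  γ-injective : (c c′ : Fin N → ℤ) → Draconian (adj G) c → Draconian (adj G) c′ →
                (∀ i → γ G u v c i ≡ γ G u v c′ i) → ∀ i → c i ≡ c′ i
  γ-injective c c′ dc dc′ γ≗γ with γ-case c | γ-case c′
  ... | subdivided _ e      | subdivided _ e′       = γ′-injective u (relate γ≗γ e e′)
  ... | subdivided _ e      | pushed-u _ _ e′       = ⊥-elim (γ′≢pushTo u u (relate γ≗γ e e′ new))
  ... | subdivided _ e      | pushed-v _ _ e′       = ⊥-elim (γ′≢pushTo u v (relate γ≗γ e e′ new))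
  ... | pushed-u _ _ e      | subdivided _ e′       = ⊥-elim (γ′≢pushTo u u (≡.sym (relate γ≗γ e e′ new)))
  ... | pushed-v _ _ e      | subdivided _ e′       = ⊥-elim (γ′≢pushTo u v (≡.sym (relate γ≗γ e e′ new)))
  ... | pushed-u _ _ e      | pushed-u _ _ e′       = pushTo-injective u (relate γ≗γ e e′)
  ... | pushed-v _ _ e      | pushed-v _ _ e′       = pushTo-injective v (relate γ≗γ e e′)
  ... | pushed-u _ c∉D′ e   | pushed-v γ′∉D c′∈D′ e′ =
    ⊥-elim (pushTo-u≢pushTo-v dc dc′ c∉D′ c′∈D′ γ′∉D (relate γ≗γ e e′))
  ... | pushed-v γ′∉D c∈D′ e | pushed-u _ c′∉D′ e′  =
    ⊥-elim (pushTo-u≢pushTo-v dc′ dc c′∉D′ c∈D′ γ′∉D (≡.sym ∘ relate γ≗γ e e′))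

lemma3p8 : (N : ℕ) (G : SimpleGraph N) → TwoConnected G →
    (u v : Fin N) → adj G u v ≡ true → deg G u ≡ 2 →
    ((c : Fin N → ℤ) → Draconian (adj G) c →
      Draconian (subdivide (adj G) u v) (γ G u v c))
    × ((c c′ : Fin N → ℤ) → Draconian (adj G) c → Draconian (adj G) c′ →
      (∀ i → γ G u v c i ≡ γ G u v c′ i) → ∀ i → c i ≡ c′ i)
lemma3p8 N G _ u v uv _ = γ-draconian , γ-injective
  where
  u≢v : u ≢ v
  u≢v refl = true≢false uv (irrefl G u)
  open Gamma G u≢v
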